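{- Let $\mathbf x$ be an infinite word over a finite alphabet and $n \ge 1$ an integer, and suppose $\mathbf z_n \ne \mathbf z_{n+1}$. Let $y$ be the letter such that $wy$ is the prefix of length $n$ of $\mathbf z_{n+1}$ (with $w$ of length $n-1$), and let $x$ be the last letter of $a_{n+1}$. Then $w$ is a bispecial factor of $\mathbf z_n$, the word $xwy$ is a factor of $\mathbf z_n$ of length $n+1$, but $xwy$ is not a factor of $\mathbf z_{n+1}$. In particular, $wy$ is a left-special word.
   Context: For an infinite word $\mathbf x$, a factor is recurrent if it occurs infinitely often in $\mathbf x$; $\mathbf x$ is $n$-recurrent if every factor of length $n$ of $\mathbf x$ is recurrent. For $n\ge1$, $a_n$ denotes the shortest prefix of $\mathbf x$ such that $\mathbf x = a_n \mathbf z_n$ with $\mathbf z_n$ an $n$-recurrent infinite word, and $s_n = |a_n|$. A factor $u$ of a word is right-special (resp. left-special) if there are distinct letters $c,d$ with $uc, ud$ (resp. $cu, du$) both factors; bispecial means both right- and left-special. -}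

module Defs where

open import Data.Nat using (ℕ; zero; suc; _+_; _∸_; _≤_; _<_)
open import Data.Fin using (Fin; toℕ)
open import Data.Vec using (Vec; _∷_; _∷ʳ_; lookup; tabulate)
open import Data.Product using (Σ; ∃; _×_)
open import Relation.Binary.PropositionalEquality using (_≡_; _≢_)
open import Relation.Nullary using (¬_)

Word : ℕ → Set
Word k = ℕ → Fin k

shift : ∀ {k} → ℕ → Word k → Word k
shift s x i = x (s + i)

OccursAt : ∀ {k m} → Word k → Vec (Fin k) m → ℕ → Set
OccursAt z u i = ∀ j → z (i + toℕ j) ≡ lookup u j

Factor : ∀ {k m} → Word k → Vec (Fin k) m → Set
Factor z u = ∃ λ i → OccursAt z u i

Recurrent : ∀ {k m} → Word k → Vec (Fin k) m → Set
Recurrent z u = ∀ N → ∃ λ i → N ≤ i × OccursAt z u i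

NRecurrent : ∀ {k} → ℕ → Word k → Set
NRecurrent n z = ∀ (u : Vec _ n) → Factor z u → Recurrent z u

-- s = s_n = |a_n|: the least length of a prefix whose removal leaves an n-recurrent word.
IsSn : ∀ {k} → Word k → ℕ → ℕ → Set
IsSn x n s = NRecurrent n (shift s x) × (∀ t → t < s → ¬ NRecurrent n (shift t x))

RightSpecial : ∀ {k m} → Word k → Vec (Fin k) m → Set
RightSpecial z u = ∃ λ c → ∃ λ d → c ≢ d × Factor z (u ∷ʳ c) × Factor z (u ∷ʳ d)

LeftSpecial : ∀ {k m} → Word k → Vec (Fin k) m → Set
LeftSpecial z u = ∃ λ c → ∃ λ d → c ≢ d × Factor z (c ∷ u) × Factor z (d ∷ u)

Bispecial : ∀ {k m} → Word k → Vec (Fin k) m → Set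
Bispecial z u = RightSpecial z u × LeftSpecial z u

block : ∀ {k} → Word k → ℕ → (m : ℕ) → Vec (Fin k) m
block z i m = tabulate (λ j → z (i + toℕ j))

-- Since s_n < s_{n+1} = t + 1, the word z_{n+1} = x[t+1..] is (n+1)-recurrent while x[t..] is not,
-- so the block u = x w y of length n+1 at position t is not recurrent; it is therefore a factor of
-- z_n but not of z_{n+1}. The recurrent factors w y and x w of z_n reoccur inside z_{n+1}, where
-- their neighbouring letters must differ from x and from y respectively: this makes w y (hence w)
-- left special and x w (hence w) right special.
module Submission where

open import Defs
open import Data.Nat using (ℕ; zero; suc; _+_; _∸_; _≤_; _<_; s≤s)
open import Data.Nat.Properties
open import Data.Fin using (Fin; toℕ)
open import Data.Vec using (Vec; _∷_; _∷ʳ_; lookup)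
open import Data.Vec.Properties
  using (∷-injectiveʳ; ∷ʳ-injectiveˡ; lookup∘tabulate; tabulate∘lookup; tabulate-cong)
open import Data.Product using (_×_; _,_; ∃)
open import Data.Sum using (inj₁; inj₂)
open import Data.Empty using (⊥; ⊥-elim)
open import Relation.Binary.PropositionalEquality
  using (_≡_; refl; sym; trans; cong; cong₂; subst; module ≡-Reasoning)
open import Relation.Nullary using (¬_)

module _ {k : ℕ} where

  occursAt⇒block≡ : ∀ {m} (z : Word k) i {u : Vec (Fin k) m} → OccursAt z u i → block z i m ≡ u
  occursAt⇒block≡ z i {u} o = trans (tabulate-cong o) (tabulate∘lookup u)

  block≡⇒occursAt : ∀ {m} (z : Word k) i {u : Vec (Fin k) m} → block z i m ≡ u → OccursAt z u i
  block≡⇒occursAt z i e j = trans (sym (lookup∘tabulate _ j)) (cong (λ v → lookup v j) e)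

  block-shift : ∀ (z : Word k) a i m → block (shift a z) i m ≡ block z (a + i) m
  block-shift z a i m = tabulate-cong (λ j → cong z (sym (+-assoc a i (toℕ j))))

  block-suc : ∀ (z : Word k) i m → block z i (suc m) ≡ z i ∷ block z (suc i) m
  block-suc z i m =
    cong₂ _∷_ (cong z (+-identityʳ i)) (tabulate-cong (λ j → cong z (+-suc i (toℕ j))))

  block-suc-∷ʳ : ∀ (z : Word k) i m → block z i (suc m) ≡ block z i m ∷ʳ z (i + m)
  block-suc-∷ʳ z i zero    = refl
  block-suc-∷ʳ z i (suc m) = begin
    block z i (suc (suc m))                          ≡⟨ block-suc z i (suc m) ⟩
    z i ∷ block z (suc i) (suc m)                    ≡⟨ cong (z i ∷_) (block-suc-∷ʳ z (suc i) m) ⟩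
    z i ∷ (block z (suc i) m ∷ʳ z (suc i + m))       ≡⟨ cong (λ q → z i ∷ (block z (suc i) m ∷ʳ z q)) (sym (+-suc i m)) ⟩
    (z i ∷ block z (suc i) m) ∷ʳ z (i + suc m)       ≡⟨ cong (_∷ʳ z (i + suc m)) (sym (block-suc z i m)) ⟩
    block z i (suc m) ∷ʳ z (i + suc m)               ∎
    where open ≡-Reasoning

  factor-tail : ∀ {m} (z : Word k) c (v : Vec (Fin k) m) → Factor z (c ∷ v) → Factor z v
  factor-tail {m} z c v (i , o) =
    suc i , block≡⇒occursAt z (suc i)
              (∷-injectiveʳ (trans (sym (block-suc z i m)) (occursAt⇒block≡ z i o)))

  factor-init : ∀ {m} (z : Word k) (v : Vec (Fin k) m) c → Factor z (v ∷ʳ c) → Factor z v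
  factor-init {m} z v c (i , o) =
    i , block≡⇒occursAt z i
          (∷ʳ-injectiveˡ _ v (trans (sym (block-suc-∷ʳ z i m)) (occursAt⇒block≡ z i o)))

  rightSpecial-tail : ∀ {m} (z : Word k) c (v : Vec (Fin k) m) → RightSpecial z (c ∷ v) → RightSpecial z v
  rightSpecial-tail z c v (d , e , d≢e , fd , fe) =
    d , e , d≢e , factor-tail z c (v ∷ʳ d) fd , factor-tail z c (v ∷ʳ e) fe

  leftSpecial-init : ∀ {m} (z : Word k) (v : Vec (Fin k) m) c → LeftSpecial z (v ∷ʳ c) → LeftSpecial z v
  leftSpecial-init z v c (d , e , d≢e , fd , fe) =
    d , e , d≢e , factor-init z (d ∷ v) c fd , factor-init z (e ∷ v) c fe

  nRecurrent-pred : ∀ {n} (z : Word k) → NRecurrent (suc n) z → NRecurrent n z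
  nRecurrent-pred {n} z R v (i , o) N with R (block z i (suc n)) (i , block≡⇒occursAt z i refl) N
  ... | j , N≤j , o′ = j , N≤j , block≡⇒occursAt z j (trans blocks-agree (occursAt⇒block≡ z i {v} o))
    where
    blocks-agree : block z j n ≡ block z i n
    blocks-agree = ∷ʳ-injectiveˡ _ _ (begin
      block z j n ∷ʳ z (j + n)  ≡⟨ sym (block-suc-∷ʳ z j n) ⟩
      block z j (suc n)         ≡⟨ occursAt⇒block≡ z j o′ ⟩
      block z i (suc n)         ≡⟨ block-suc-∷ʳ z i n ⟩
      block z i n ∷ʳ z (i + n)  ∎)
      where open ≡-Reasoning

  module _ (x : Word k) where

    occursAt-shift : ∀ {m} {u : Vec (Fin k) m} {a p} → a ≤ p → block x p m ≡ u
      → OccursAt (shift a x) u (p ∸ a)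
    occursAt-shift {m} {u} {a} {p} a≤p e = block≡⇒occursAt (shift a x) (p ∸ a) (begin
      block (shift a x) (p ∸ a) m  ≡⟨ block-shift x a (p ∸ a) m ⟩
      block x (a + (p ∸ a)) m      ≡⟨ cong (λ q → block x q m) (m+[n∸m]≡n a≤p) ⟩
      block x p m                  ≡⟨ e ⟩
      u                            ∎)
      where open ≡-Reasoning

    factor-shift : ∀ {m} {u : Vec (Fin k) m} {a p} → a ≤ p → block x p m ≡ u → Factor (shift a x) u
    factor-shift a≤p e = _ , occursAt-shift a≤p e

    factor-position : ∀ {m} a (u : Vec (Fin k) m) → Factor (shift a x) u → ∃ λ p → a ≤ p × block x p m ≡ u
    factor-position {m} a u (i , o) =
      a + i , m≤m+n a i , trans (sym (block-shift x a i m)) (occursAt⇒block≡ (shift a x) i o)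

    recurrent-beyond : ∀ {m} a (u : Vec (Fin k) m) → Recurrent (shift a x) u
      → ∀ N → ∃ λ p → N ≤ p × block x p m ≡ u
    recurrent-beyond {m} a u R N with R N
    ... | i , N≤i , o =
      a + i , ≤-trans N≤i (m≤n+m i a) , trans (sym (block-shift x a i m)) (occursAt⇒block≡ (shift a x) i o)

    recurrent-shift : ∀ {m} a b (u : Vec (Fin k) m) → Recurrent (shift a x) u → Recurrent (shift b x) u
    recurrent-shift a b u R N with recurrent-beyond a u R (N + b)
    ... | p , N+b≤p , e = p ∸ b , m+n≤o⇒m≤o∸n N N+b≤p , occursAt-shift (≤-trans (m≤n+m b N) N+b≤p) e

    -- If x[t+1..] is n-recurrent but x[t..] is not, the culprit can only be the block at t.
    leading-block-not-recurrent : ∀ n t → NRecurrent n (shift (suc t) x) → ¬ NRecurrent n (shift t x)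
      → ¬ Recurrent (shift t x) (block x t n)
    leading-block-not-recurrent n t R ¬R rec = ¬R recurrent
      where
      recurrent : NRecurrent n (shift t x)
      recurrent v f with factor-position t v f
      ... | p , t≤p , e with m≤n⇒m<n∨m≡n t≤p
      ... | inj₁ t<p  = recurrent-shift (suc t) t v (R v (factor-shift t<p e))
      ... | inj₂ refl = subst (Recurrent (shift t x)) e rec

    rightSpecial-of-missing-extension : ∀ {m} (v : Vec (Fin k) m) c {a b} → a ≤ b
      → Recurrent (shift a x) v → Factor (shift a x) (v ∷ʳ c) → ¬ Factor (shift b x) (v ∷ʳ c)
      → RightSpecial (shift a x) v
    rightSpecial-of-missing-extension {m} v c {a} {b} a≤b rec fc ¬fc with recurrent-beyond a v rec b
    ... | p , b≤p , e = c , x (p + m) , c≢d , fc , factor-shift (≤-trans a≤b b≤p) extended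
      where
      extended : block x p (suc m) ≡ v ∷ʳ x (p + m)
      extended = trans (block-suc-∷ʳ x p m) (cong (_∷ʳ x (p + m)) e)
      c≢d : c ≡ x (p + m) → ⊥
      c≢d refl = ¬fc (factor-shift b≤p extended)

    leftSpecial-of-missing-extension : ∀ {m} (v : Vec (Fin k) m) c {a b} → a ≤ b
      → Recurrent (shift a x) v → Factor (shift a x) (c ∷ v) → ¬ Factor (shift b x) (c ∷ v)
      → LeftSpecial (shift a x) v
    leftSpecial-of-missing-extension {m} v c {a} {b} a≤b rec fc ¬fc with recurrent-beyond a v rec (suc b)
    ... | suc q , s≤s b≤q , e = c , x q , c≢d , fc , factor-shift (≤-trans a≤b b≤q) extended
      where
      extended : block x q (suc m) ≡ x q ∷ v
      extended = trans (block-suc x q m) (cong (x q ∷_) e)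
      c≢d : c ≡ x q → ⊥
      c≢d refl = ¬fc (factor-shift b≤q extended)

    sₙ<sₙ₊₁ : ∀ n s s′ → IsSn x n s → IsSn x (suc n) s′ → ¬ (∀ i → shift s x i ≡ shift s′ x i) → s < s′
    sₙ<sₙ₊₁ n s s′ (_ , minimal) (nRecurrent′ , _) z≢z′ =
      ≤∧≢⇒< (≮⇒≥ (λ s′<s → minimal s′ s′<s (nRecurrent-pred (shift s′ x) nRecurrent′)))
            (λ { refl → z≢z′ (λ _ → refl) })

lemma2p6 : ∀ {k} (x : Word k) (m s s' : ℕ)
    → IsSn x (suc m) s → IsSn x (suc (suc m)) s'
    → ¬ (∀ i → shift s x i ≡ shift s' x i)
    → Bispecial (shift s x) (block x s' m)
      × Factor (shift s x) (x (s' ∸ 1) ∷ (block x s' m ∷ʳ x (s' + m)))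
      × ¬ Factor (shift s' x) (x (s' ∸ 1) ∷ (block x s' m ∷ʳ x (s' + m)))
      × LeftSpecial (shift s x) (block x s' m ∷ʳ x (s' + m))
lemma2p6 x m s zero Hs Hs' z≢z′ = ⊥-elim (n≮0 (sₙ<sₙ₊₁ x (suc m) s zero Hs Hs' z≢z′))
lemma2p6 x m s (suc t) Hs@(nRecurrent , _) Hs'@(nRecurrent′ , minimal′) z≢z′ =
  (w-rightSpecial , leftSpecial-init (shift s x) w y wy-leftSpecial) , u-factor , u-missing , wy-leftSpecial
  where
  s<s′ : s < suc t
  s<s′ = sₙ<sₙ₊₁ x (suc m) s (suc t) Hs Hs' z≢z′

  w = block x (suc t) m
  y = x (suc t + m)
  u = x t ∷ (w ∷ʳ y)

  u-block : block x t (suc (suc m)) ≡ u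
  u-block = trans (block-suc x t (suc m)) (cong (x t ∷_) (block-suc-∷ʳ x (suc t) m))

  u-missing : ¬ Factor (shift (suc t) x) u
  u-missing f = leading-block-not-recurrent x (suc (suc m)) t nRecurrent′ (minimal′ t ≤-refl)
    (subst (Recurrent (shift t x)) (sym u-block) (recurrent-shift x (suc t) t u (nRecurrent′ u f)))

  u-factor : Factor (shift s x) u
  u-factor = factor-shift x (≤-pred s<s′) u-block

  wy-leftSpecial : LeftSpecial (shift s x) (w ∷ʳ y)
  wy-leftSpecial = leftSpecial-of-missing-extension x (w ∷ʳ y) (x t) (<⇒≤ s<s′)
    (nRecurrent (w ∷ʳ y) (factor-tail (shift s x) (x t) (w ∷ʳ y) u-factor)) u-factor u-missing

  w-rightSpecial : RightSpecial (shift s x) w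
  w-rightSpecial = rightSpecial-tail (shift s x) (x t) w
    (rightSpecial-of-missing-extension x (x t ∷ w) y (<⇒≤ s<s′)
      (nRecurrent (x t ∷ w) (factor-init (shift s x) (x t ∷ w) y u-factor)) u-factor u-missing)
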